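{- Let $n\ge1$ and let $\omega$ be a primitive complex root of unity of order $n$. Let $$A_\omega(t)=\begin{bmatrix}1&\omega^{n-1}\\ t&0\end{bmatrix}\begin{bmatrix}1&\omega^{n-2}\\ t&0\end{bmatrix}\cdots\begin{bmatrix}1&1\\ t&0\end{bmatrix}$$ (the product of the matrices $\begin{bmatrix}1&\omega^{j}\\ t&0\end{bmatrix}$ for $j=n-1,n-2,\ldots,0$ in this order), and $A(t)=\begin{bmatrix}1&t\\1&0\end{bmatrix}$. Then $A_\omega(t)$ and $A(t^n)$ have the same characteristic polynomial. -}

module Defs where

open import Level using (_⊔_)
open import Algebra.Bundles using (CommutativeRing)
open import Data.Nat using (ℕ; zero; suc; _≤_; _<_)
open import Data.Sum using (_⊎_)
open import Data.Product using (_×_)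
open import Data.Vec using (Vec; []; _∷_)
open import Data.Vec.Relation.Binary.Pointwise.Inductive using (Pointwise)
open import Relation.Nullary using (¬_)

module _ {c ℓ} (R : CommutativeRing c ℓ) where
  open CommutativeRing R

  IsIntegralDomain : Set (c ⊔ ℓ)
  IsIntegralDomain = (¬ (1# ≈ 0#)) × (∀ x y → x * y ≈ 0# → (x ≈ 0#) ⊎ (y ≈ 0#))

  pow : Carrier → ℕ → Carrier
  pow x zero    = 1#
  pow x (suc k) = x * pow x k

  IsPrimitiveRoot : ℕ → Carrier → Set ℓ
  IsPrimitiveRoot n ω = (pow ω n ≈ 1#) × (∀ k → 1 ≤ k → k < n → ¬ (pow ω k ≈ 1#))

  record Mat2 : Set c where
    constructor mat
    field
      a₁₁ a₁₂ a₂₁ a₂₂ : Carrier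

  I₂ : Mat2
  I₂ = mat 1# 0# 0# 1#

  _⊗_ : Mat2 → Mat2 → Mat2
  mat a b c' d ⊗ mat e f g h = mat (a * e + b * g) (a * f + b * h) (c' * e + d * g) (c' * f + d * h)

  -- characteristic polynomial det(x I - M) = x² - (a+d) x + (ad - bc),
  -- as its coefficient vector [constant, x¹, x²]
  charPoly : Mat2 → Vec Carrier 3
  charPoly (mat a b c' d) = (a * d - b * c') ∷ (- (a + d)) ∷ 1# ∷ []

  _≈ₚ_ : Vec Carrier 3 → Vec Carrier 3 → Set (c ⊔ ℓ)
  p ≈ₚ q = Pointwise _≈_ p q

  M : Carrier → Carrier → ℕ → Mat2
  M ω t j = mat 1# (pow ω j) t 0#

  prodM : Carrier → Carrier → ℕ → Mat2
  prodM ω t zero    = I₂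
  prodM ω t (suc k) = M ω t k ⊗ prodM ω t k

  Aω : ℕ → Carrier → Carrier → Mat2
  Aω n ω t = prodM ω t n

  A : Carrier → Mat2
  A t = mat 1# t 1# 0#

module Submission where

-- A 2×2 characteristic
-- polynomial is determined by determinant and trace, so we show
--   det A_ω(t) = −tⁿ   and   tr A_ω(t) = 1,
-- which are the determinant and trace of A(tⁿ) = [[1 , tⁿ] , [1 , 0]].
--
-- Determinant: det is multiplicative and det M_j = −ω^j t, so det A_ω(t) = (−1)ⁿ ω^(tri n) tⁿ
-- with tri n = 0 + 1 + ⋯ + (n−1); a parity argument shows (−1)ⁿ ω^(tri n) = −1.
--
-- Trace: we compute with polynomial matrices in an indeterminate T (coefficient sequences).
-- Let Π a k = F(a_{k−1}) ⋯ F(a_0) with F(x) = [[1 , x] , [T , 0]].  By associativity and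
-- cyclicity of the trace, tr Π a n = tr Π (a ∘ suc) n whenever a_n = a_0; and when
-- a_{j+1} = ω a_j, Π (a ∘ suc) k is Π a k with T replaced by ωT, conjugated by diag(1, ω).
-- For a_j = ω^j the trace coefficients therefore satisfy c_m = ω^m c_m, so c_m = 0 for
-- 0 < m < n; coefficients with m ≥ n vanish by a degree bound (entries of Π a k have degree
-- at most k/2), and c_0 = 1.  Evaluating at T = t gives tr A_ω(t) = 1.

open import Defs
open import Algebra.Bundles using (CommutativeRing)
open import Data.Nat as ℕ using (ℕ; zero; suc; _≤_; _<_; _<?_; z≤n; s≤s)
import Data.Nat.Properties as ℕₚ
open import Data.Nat.Tactic.RingSolver using (solve-∀)
open import Data.Product using (_,_; ∃-syntax)
open import Data.Sum using (_⊎_; inj₁; inj₂; fromInj₂)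
open import Data.Vec.Relation.Binary.Pointwise.Inductive using ([]; _∷_)
open import Function using (_∘_)
open import Relation.Nullary using (¬_; yes; no; contradiction)
open import Relation.Binary.PropositionalEquality as P using (_≡_)

parity : ∀ n → ∃[ m ] (n ≡ m ℕ.+ m ⊎ n ≡ suc (m ℕ.+ m))
parity zero = 0 , inj₁ P.refl
parity (suc n) with parity n
... | m , inj₁ n≡2m   = m , inj₂ (P.cong suc n≡2m)
... | m , inj₂ n≡2m+1 = suc m , inj₁ (P.cong suc (P.trans n≡2m+1 (P.sym (ℕₚ.+-suc m m))))

-- Triangular numbers tri k = 0 + 1 + ⋯ + (k − 1), the exponent of ∏_{j<k} ω^j.
tri : ℕ → ℕ
tri zero    = 0
tri (suc k) = k ℕ.+ tri k

tri-step₂ : ∀ m → tri (suc m ℕ.+ suc m) ≡ suc (m ℕ.+ m) ℕ.+ tri (suc (m ℕ.+ m))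
tri-step₂ m = P.cong (tri ∘ suc) (ℕₚ.+-suc m m)

tri-odd : ∀ m → tri (suc (m ℕ.+ m)) ≡ suc (m ℕ.+ m) ℕ.* m
tri-odd zero    = P.refl
tri-odd (suc m) = begin
  tri (suc (suc m ℕ.+ suc m))                          ≡⟨⟩
  (suc m ℕ.+ suc m) ℕ.+ tri (suc m ℕ.+ suc m)           ≡⟨ P.cong ((suc m ℕ.+ suc m) ℕ.+_) (tri-step₂ m) ⟩
  (suc m ℕ.+ suc m) ℕ.+ (suc (m ℕ.+ m) ℕ.+ tri (suc (m ℕ.+ m)))
    ≡⟨ P.cong (λ x → (suc m ℕ.+ suc m) ℕ.+ (suc (m ℕ.+ m) ℕ.+ x)) (tri-odd m) ⟩
  (suc m ℕ.+ suc m) ℕ.+ (suc (m ℕ.+ m) ℕ.+ suc (m ℕ.+ m) ℕ.* m) ≡⟨ arith m ⟩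
  suc (suc m ℕ.+ suc m) ℕ.* suc m ∎
  where
  open P.≡-Reasoning
  arith : ∀ m → (suc m ℕ.+ suc m) ℕ.+ (suc (m ℕ.+ m) ℕ.+ suc (m ℕ.+ m) ℕ.* m) ≡ suc (suc m ℕ.+ suc m) ℕ.* suc m
  arith = solve-∀

tri-even : ∀ m → tri (suc m ℕ.+ suc m) ≡ suc m ℕ.* suc (m ℕ.+ m)
tri-even m = begin
  tri (suc m ℕ.+ suc m)                               ≡⟨ tri-step₂ m ⟩
  suc (m ℕ.+ m) ℕ.+ tri (suc (m ℕ.+ m))                ≡⟨ P.cong (suc (m ℕ.+ m) ℕ.+_) (tri-odd m) ⟩
  suc (m ℕ.+ m) ℕ.+ suc (m ℕ.+ m) ℕ.* m                ≡⟨ arith m ⟩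
  suc m ℕ.* suc (m ℕ.+ m) ∎
  where
  open P.≡-Reasoning
  arith : ∀ m → suc (m ℕ.+ m) ℕ.+ suc (m ℕ.+ m) ℕ.* m ≡ suc m ℕ.* suc (m ℕ.+ m)
  arith = solve-∀

halve-bound : ∀ {j m} → suc (suc j) ≤ suc m ℕ.+ suc m → j ≤ m ℕ.+ m
halve-bound {j} {m} h =
  ℕₚ.≤-pred (ℕₚ.≤-pred (P.subst (suc (suc j) ≤_) (P.cong suc (ℕₚ.+-suc m m)) h))

module _ {c ℓ} (R : CommutativeRing c ℓ) where
  open CommutativeRing R
  open import Relation.Binary.Reasoning.Setoid setoid
  open import Algebra.Properties.Semiring.Exp semiring using (_^_; ^-homo-*; ^-assocʳ; ^-congˡ)
  open import Algebra.Properties.Group +-group using (x∙y⁻¹≈ε⇒x≈y; inverseˡ-unique; ε⁻¹≈ε; ⁻¹-involutive)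
  open import Algebra.Properties.AbelianGroup +-abelianGroup using (⁻¹-∙-comm; xyx⁻¹≈y)
  open import Algebra.Properties.Ring ring using (-‿distribˡ-*; -‿distribʳ-*; [y-z]x≈yx-zx; -1*x≈-x)
  open import Algebra.Solver.Ring.NaturalCoefficients.Default commutativeSemiring
    using (solve; _:+_; _:*_; _:=_)

  pow≡^ : ∀ x k → pow R x k ≡ x ^ k
  pow≡^ x zero    = P.refl
  pow≡^ x (suc k) = P.cong (x *_) (pow≡^ x k)

  pow-+ : ∀ x a b → pow R x (a ℕ.+ b) ≈ pow R x a * pow R x b
  pow-+ x a b rewrite pow≡^ x (a ℕ.+ b) | pow≡^ x a | pow≡^ x b = ^-homo-* x a b

  pow-* : ∀ x a b → pow R (pow R x a) b ≈ pow R x (a ℕ.* b)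
  pow-* x a b rewrite pow≡^ (pow R x a) b | pow≡^ x a | pow≡^ x (a ℕ.* b) = ^-assocʳ x a b

  pow-cong : ∀ {x y} k → x ≈ y → pow R x k ≈ pow R y k
  pow-cong {x} {y} k x≈y rewrite pow≡^ x k | pow≡^ y k = ^-congˡ k x≈y

  pow-≡ : ∀ x {a b} → a ≡ b → pow R x a ≈ pow R x b
  pow-≡ x a≡b = reflexive (P.cong (pow R x) a≡b)

  pow-1 : ∀ k → pow R 1# k ≈ 1#
  pow-1 zero    = refl
  pow-1 (suc k) = trans (*-identityˡ _) (pow-1 k)

  pow-minus-one-even : ∀ m → pow R (- 1#) (m ℕ.+ m) ≈ 1#
  pow-minus-one-even zero = refl
  pow-minus-one-even (suc m) rewrite ℕₚ.+-suc m m = begin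
    - 1# * (- 1# * pow R (- 1#) (m ℕ.+ m)) ≈⟨ *-congˡ (*-congˡ (pow-minus-one-even m)) ⟩
    - 1# * (- 1# * 1#)                     ≈⟨ *-congˡ (*-identityʳ _) ⟩
    - 1# * - 1#                            ≈⟨ -1*x≈-x (- 1#) ⟩
    - - 1#                                 ≈⟨ ⁻¹-involutive 1# ⟩
    1#                                     ∎

  pow-minus-one-odd : ∀ m → pow R (- 1#) (suc (m ℕ.+ m)) ≈ - 1#
  pow-minus-one-odd m = trans (*-congˡ (pow-minus-one-even m)) (*-identityʳ _)

  fixed-point-zero : IsIntegralDomain R → ∀ x y → x * y ≈ y → ¬ x ≈ 1# → y ≈ 0#
  fixed-point-zero (_ , no-zero-divisors) x y xy≈y x≉1 =
    fromInj₂ (λ x-1≈0 → contradiction (x∙y⁻¹≈ε⇒x≈y x 1# x-1≈0) x≉1)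
             (no-zero-divisors (x - 1#) y [x-1]y≈0)
    where
    [x-1]y≈0 : (x - 1#) * y ≈ 0#
    [x-1]y≈0 = begin
      (x - 1#) * y   ≈⟨ [y-z]x≈yx-zx y x 1# ⟩
      x * y - 1# * y ≈⟨ +-cong xy≈y (-‿cong (*-identityˡ y)) ⟩
      y - y          ≈⟨ -‿inverseʳ y ⟩
      0#             ∎

  -- Consequently the only square root of 1 other than 1 is −1 (it fixes x + 1).
  square-root-of-one : IsIntegralDomain R → ∀ x → x * x ≈ 1# → ¬ x ≈ 1# → x ≈ - 1#
  square-root-of-one dom x xx≈1 x≉1 =
    inverseˡ-unique x 1# (fixed-point-zero dom x (x + 1#) x[x+1]≈x+1 x≉1)
    where
    x[x+1]≈x+1 : x * (x + 1#) ≈ x + 1#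
    x[x+1]≈x+1 = begin
      x * (x + 1#)      ≈⟨ distribˡ x x 1# ⟩
      x * x + x * 1#    ≈⟨ +-cong xx≈1 (*-identityʳ x) ⟩
      1# + x            ≈⟨ +-comm 1# x ⟩
      x + 1#            ∎

  -- ∏_{j<n} (−ω^j) = (−1)ⁿ ω^(tri n) = −1 for a primitive n-th root of unity ω.
  -- For odd n = 2m+1, tri n = n m and ω^(tri n) = 1; for even n = 2m, ω^m = −1 and
  -- ω^(tri n) = (ω^m)^(2m−1) = −1.
  primitive-root-sign : IsIntegralDomain R → ∀ n → 1 ≤ n → ∀ ω → IsPrimitiveRoot R n ω →
    pow R (- 1#) n * pow R ω (tri n) ≈ - 1#
  primitive-root-sign dom n 1≤n ω (ωⁿ≈1 , ωᵏ≉1) with parity n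
  ... | zero , inj₁ P.refl = contradiction 1≤n λ ()
  ... | m , inj₂ P.refl = begin
    pow R (- 1#) n * pow R ω (tri n) ≈⟨ *-cong (pow-minus-one-odd m) (pow-≡ ω (tri-odd m)) ⟩
    - 1# * pow R ω (n ℕ.* m)         ≈⟨ *-congˡ (pow-* ω n m) ⟨
    - 1# * pow R (pow R ω n) m       ≈⟨ *-congˡ (trans (pow-cong m ωⁿ≈1) (pow-1 m)) ⟩
    - 1# * 1#                        ≈⟨ *-identityʳ _ ⟩
    - 1#                             ∎
  ... | suc m , inj₁ P.refl = begin
    pow R (- 1#) n * pow R ω (tri n)       ≈⟨ *-cong (pow-minus-one-even (suc m)) (pow-≡ ω (tri-even m)) ⟩
    1# * pow R ω (suc m ℕ.* suc (m ℕ.+ m)) ≈⟨ *-identityˡ _ ⟩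
    pow R ω (suc m ℕ.* suc (m ℕ.+ m))      ≈⟨ pow-* ω (suc m) (suc (m ℕ.+ m)) ⟨
    pow R (pow R ω (suc m)) (suc (m ℕ.+ m)) ≈⟨ pow-cong (suc (m ℕ.+ m)) half-turn ⟩
    pow R (- 1#) (suc (m ℕ.+ m))           ≈⟨ pow-minus-one-odd m ⟩
    - 1#                                   ∎
    where
    half-turn : pow R ω (suc m) ≈ - 1#
    half-turn = square-root-of-one dom (pow R ω (suc m))
      (trans (sym (pow-+ ω (suc m) (suc m))) ωⁿ≈1)
      (ωᵏ≉1 (suc m) (s≤s z≤n) (ℕₚ.m<m+n (suc m) (s≤s z≤n)))

  det : Mat2 R → Carrier
  det (mat a b c' d) = a * d - b * c'

  difference-cong : ∀ {a b c' d} → a + d ≈ c' + b → a - b ≈ c' - d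
  difference-cong {a} {b} {c'} {d} a+d≈c+b = begin
    a - b           ≈⟨ xyx⁻¹≈y d (a - b) ⟨
    d + (a - b) - d ≈⟨ +-congʳ (solve 3 (λ a nb d → d :+ (a :+ nb) := (a :+ d) :+ nb) refl a (- b) d) ⟩
    a + d - b - d   ≈⟨ +-congʳ (+-congʳ (trans a+d≈c+b (+-comm c' b))) ⟩
    b + c' - b - d  ≈⟨ +-congʳ (xyx⁻¹≈y b c') ⟩
    c' - d          ∎

  difference-product : ∀ x y u v → (x - y) * (u - v) ≈ (x * u + y * v) - (x * v + y * u)
  difference-product x y u v = begin
    (x - y) * (u - v)
      ≈⟨ solve 4 (λ x ny u nv → (x :+ ny) :* (u :+ nv) := (x :* u :+ ny :* nv) :+ (x :* nv :+ ny :* u))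
                 refl x (- y) u (- v) ⟩
    (x * u + - y * - v) + (x * - v + - y * u)
      ≈⟨ +-cong (+-congˡ -y*-v≈yv) (+-cong (sym (-‿distribʳ-* x v)) (sym (-‿distribˡ-* y u))) ⟩
    (x * u + y * v) + (- (x * v) + - (y * u))
      ≈⟨ +-congˡ (⁻¹-∙-comm (x * v) (y * u)) ⟩
    (x * u + y * v) - (x * v + y * u) ∎
    where
    -y*-v≈yv : - y * - v ≈ y * v
    -y*-v≈yv = begin
      - y * - v   ≈⟨ -‿distribˡ-* y (- v) ⟨
      - (y * - v) ≈⟨ -‿cong (-‿distribʳ-* y v) ⟨
      - - (y * v) ≈⟨ ⁻¹-involutive (y * v) ⟩
      y * v       ∎

  det-⊗ : ∀ X Y → det (_⊗_ R X Y) ≈ det X * det Y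
  det-⊗ (mat a b c' d) (mat e f g h) = begin
    (a * e + b * g) * (c' * f + d * h) - (a * f + b * h) * (c' * e + d * g)
      ≈⟨ difference-cong (solve 8 (λ a b c d e f g h →
           (a :* e :+ b :* g) :* (c :* f :+ d :* h) :+ (a :* d :* (f :* g) :+ b :* c :* (e :* h))
           := (a :* d :* (e :* h) :+ b :* c :* (f :* g)) :+ (a :* f :+ b :* h) :* (c :* e :+ d :* g))
           refl a b c' d e f g h) ⟩
    (a * d * (e * h) + b * c' * (f * g)) - (a * d * (f * g) + b * c' * (e * h))
      ≈⟨ difference-product (a * d) (b * c') (e * h) (f * g) ⟨
    (a * d - b * c') * (e * h - f * g) ∎

  det-prodM : ∀ ω t k → det (prodM R ω t k) ≈ pow R (- 1#) k * pow R ω (tri k) * pow R t k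
  det-prodM ω t zero =
    trans (+-congˡ (trans (-‿cong (zeroˡ 0#)) ε⁻¹≈ε)) (trans (+-identityʳ _) (sym (*-identityʳ _)))
  det-prodM ω t (suc k) = begin
    det (prodM R ω t (suc k))
      ≈⟨ det-⊗ (M R ω t k) (prodM R ω t k) ⟩
    det (M R ω t k) * det (prodM R ω t k)
      ≈⟨ *-cong det-factor (det-prodM ω t k) ⟩
    - 1# * (w * t) * (s * W * T)
      ≈⟨ solve 6 (λ n w t s W T → n :* (w :* t) :* (s :* W :* T) := n :* s :* (w :* W) :* (t :* T))
                 refl (- 1#) w t s W T ⟩
    - 1# * s * (w * W) * (t * T)
      ≈⟨ *-congʳ (*-congˡ (pow-+ ω k (tri k))) ⟨
    pow R (- 1#) (suc k) * pow R ω (tri (suc k)) * pow R t (suc k) ∎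
    where
    w = pow R ω k
    s = pow R (- 1#) k
    W = pow R ω (tri k)
    T = pow R t k
    det-factor : det (M R ω t k) ≈ - 1# * (w * t)
    det-factor = trans (+-congʳ (zeroʳ 1#)) (trans (+-identityˡ _) (sym (-1*x≈-x (w * t))))

  det-Aω : IsIntegralDomain R → ∀ n → 1 ≤ n → ∀ ω → IsPrimitiveRoot R n ω → ∀ t →
    det (Aω R n ω t) ≈ - pow R t n
  det-Aω dom n 1≤n ω prim t = begin
    det (prodM R ω t n)                              ≈⟨ det-prodM ω t n ⟩
    pow R (- 1#) n * pow R ω (tri n) * pow R t n     ≈⟨ *-congʳ (primitive-root-sign dom n 1≤n ω prim) ⟩
    - 1# * pow R t n                                 ≈⟨ -1*x≈-x _ ⟩
    - pow R t n                                      ∎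

  -- Polynomials in an indeterminate T, as coefficient sequences.

  Poly : Set c
  Poly = ℕ → Carrier

  0ₚ 1ₚ : Poly
  0ₚ _       = 0#
  1ₚ zero    = 1#
  1ₚ (suc _) = 0#

  -- Multiplication by T.
  shift : Poly → Poly
  shift f zero    = 0#
  shift f (suc m) = f m

  shift-cong : ∀ {f g} → (∀ m → f m ≈ g m) → ∀ m → shift f m ≈ shift g m
  shift-cong f≈g zero    = refl
  shift-cong f≈g (suc m) = f≈g m

  shift-0 : ∀ m → shift 0ₚ m ≈ 0#
  shift-0 zero    = refl
  shift-0 (suc m) = refl

  shift-+ : ∀ f g m → shift (λ j → f j + g j) m ≈ shift f m + shift g m
  shift-+ f g zero    = sym (+-identityˡ 0#)
  shift-+ f g (suc m) = refl

  shift-*ˡ : ∀ a f m → shift (λ j → a * f j) m ≈ a * shift f m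
  shift-*ˡ a f zero    = sym (zeroʳ a)
  shift-*ˡ a f (suc m) = refl

  shift-*ʳ : ∀ f b m → shift (λ j → f j * b) m ≈ shift f m * b
  shift-*ʳ f b zero    = sym (zeroˡ b)
  shift-*ʳ f b (suc m) = refl

  record PMat : Set c where
    constructor pmat
    field p₁₁ p₁₂ p₂₁ p₂₂ : Poly
  open PMat

  infix 4 _≋_ _≈ₘ_

  record _≋_ (X Y : PMat) : Set ℓ where
    field
      eq₁₁ : ∀ m → p₁₁ X m ≈ p₁₁ Y m
      eq₁₂ : ∀ m → p₁₂ X m ≈ p₁₂ Y m
      eq₂₁ : ∀ m → p₂₁ X m ≈ p₂₁ Y m
      eq₂₂ : ∀ m → p₂₂ X m ≈ p₂₂ Y m
  open _≋_

  ≋-refl : ∀ {X} → X ≋ X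
  ≋-refl = record { eq₁₁ = λ _ → refl ; eq₁₂ = λ _ → refl ; eq₂₁ = λ _ → refl ; eq₂₂ = λ _ → refl }

  ≋-trans : ∀ {X Y Z} → X ≋ Y → Y ≋ Z → X ≋ Z
  ≋-trans X≋Y Y≋Z = record
    { eq₁₁ = λ m → trans (eq₁₁ X≋Y m) (eq₁₁ Y≋Z m) ; eq₁₂ = λ m → trans (eq₁₂ X≋Y m) (eq₁₂ Y≋Z m)
    ; eq₂₁ = λ m → trans (eq₂₁ X≋Y m) (eq₂₁ Y≋Z m) ; eq₂₂ = λ m → trans (eq₂₂ X≋Y m) (eq₂₂ Y≋Z m) }

  Iₚ : PMat
  Iₚ = pmat 1ₚ 0ₚ 0ₚ 1ₚ

  tr : PMat → Poly
  tr X m = p₁₁ X m + p₂₂ X m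

  tr-cong : ∀ {X Y} → X ≋ Y → ∀ m → tr X m ≈ tr Y m
  tr-cong X≋Y m = +-cong (eq₁₁ X≋Y m) (eq₂₂ X≋Y m)

  -- Multiplication by the factor F(a) = [[1 , a] , [T , 0]] on the left and on the right.

  infixr 6 _▷_
  infixl 6 _◁_

  _▷_ : Carrier → PMat → PMat
  a ▷ pmat x₁₁ x₁₂ x₂₁ x₂₂ =
    pmat (λ m → x₁₁ m + a * x₂₁ m) (λ m → x₁₂ m + a * x₂₂ m) (shift x₁₁) (shift x₁₂)

  _◁_ : PMat → Carrier → PMat
  pmat x₁₁ x₁₂ x₂₁ x₂₂ ◁ b =
    pmat (λ m → x₁₁ m + shift x₁₂ m) (λ m → x₁₁ m * b) (λ m → x₂₁ m + shift x₂₂ m) (λ m → x₂₁ m * b)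

  ▷-cong : ∀ {a b X Y} → a ≈ b → X ≋ Y → a ▷ X ≋ b ▷ Y
  ▷-cong a≈b X≋Y = record
    { eq₁₁ = λ m → +-cong (eq₁₁ X≋Y m) (*-cong a≈b (eq₂₁ X≋Y m))
    ; eq₁₂ = λ m → +-cong (eq₁₂ X≋Y m) (*-cong a≈b (eq₂₂ X≋Y m))
    ; eq₂₁ = shift-cong (eq₁₁ X≋Y)
    ; eq₂₂ = shift-cong (eq₁₂ X≋Y) }

  ▷◁-assoc : ∀ a X b → a ▷ (X ◁ b) ≋ (a ▷ X) ◁ b
  ▷◁-assoc a (pmat x₁₁ x₁₂ x₂₁ x₂₂) b = record
    { eq₁₁ = λ m → begin
        x₁₁ m + shift x₁₂ m + a * (x₂₁ m + shift x₂₂ m)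
          ≈⟨ solve 5 (λ p q a r s → p :+ q :+ a :* (r :+ s) := p :+ a :* r :+ (q :+ a :* s))
                     refl (x₁₁ m) (shift x₁₂ m) a (x₂₁ m) (shift x₂₂ m) ⟩
        x₁₁ m + a * x₂₁ m + (shift x₁₂ m + a * shift x₂₂ m)
          ≈⟨ +-congˡ (trans (shift-+ x₁₂ _ m) (+-congˡ (shift-*ˡ a x₂₂ m))) ⟨
        x₁₁ m + a * x₂₁ m + shift (λ j → x₁₂ j + a * x₂₂ j) m ∎
    ; eq₁₂ = λ m → solve 4 (λ p a r b → p :* b :+ a :* (r :* b) := (p :+ a :* r) :* b)
                           refl (x₁₁ m) a (x₂₁ m) b
    ; eq₂₁ = shift-+ x₁₁ (shift x₁₂)
    ; eq₂₂ = shift-*ʳ x₁₁ b }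

  tr-◁▷ : ∀ X b m → tr (X ◁ b) m ≈ tr (b ▷ X) m
  tr-◁▷ (pmat x₁₁ x₁₂ x₂₁ x₂₂) b m =
    solve 4 (λ p q r b → p :+ q :+ r :* b := p :+ b :* r :+ q) refl (x₁₁ m) (shift x₁₂ m) (x₂₁ m) b

  Π : (ℕ → Carrier) → ℕ → PMat
  Π a zero    = Iₚ
  Π a (suc k) = a k ▷ Π a k

  Π-right : ∀ a k → Π a (suc k) ≋ Π (a ∘ suc) k ◁ a 0
  Π-right a zero = record
    { eq₁₁ = λ m → +-congˡ (trans (zeroʳ (a 0)) (sym (shift-0 m)))
    ; eq₁₂ = λ m → trans (+-identityˡ _) (*-comm (a 0) (1ₚ m))
    ; eq₂₁ = λ m → sym (+-identityˡ _)
    ; eq₂₂ = λ m → trans (shift-0 m) (sym (zeroˡ (a 0))) }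
  Π-right a (suc k) = ≋-trans (▷-cong refl (Π-right a k)) (▷◁-assoc (a (suc k)) (Π (a ∘ suc) k) (a 0))

  tr-rotate : ∀ a k → a (suc k) ≈ a 0 → ∀ m → tr (Π a (suc k)) m ≈ tr (Π (a ∘ suc) (suc k)) m
  tr-rotate a k aₙ≈a₀ m = begin
    tr (Π a (suc k)) m              ≈⟨ tr-cong (Π-right a k) m ⟩
    tr (Π (a ∘ suc) k ◁ a 0) m      ≈⟨ tr-◁▷ (Π (a ∘ suc) k) (a 0) m ⟩
    tr (a 0 ▷ Π (a ∘ suc) k) m      ≈⟨ tr-cong (▷-cong {X = Π (a ∘ suc) k} (sym aₙ≈a₀) ≋-refl) m ⟩
    tr (Π (a ∘ suc) (suc k)) m      ∎

  -- Y = D⁻¹ X(ωT) D with D = diag(1, ω): X with T replaced by ωT, conjugated by D.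
  -- Stated without inverting ω, so the (2,1) entry of Y appears multiplied by ω.
  record Dilated (ω : Carrier) (X Y : PMat) : Set ℓ where
    field
      d₁₁ : ∀ m → p₁₁ Y m ≈ pow R ω m * p₁₁ X m
      d₁₂ : ∀ m → p₁₂ Y m ≈ pow R ω (suc m) * p₁₂ X m
      d₂₁ : ∀ m → ω * p₂₁ Y m ≈ pow R ω m * p₂₁ X m
      d₂₂ : ∀ m → p₂₂ Y m ≈ pow R ω m * p₂₂ X m
  open Dilated

  dilated-Iₚ : ∀ ω → Dilated ω Iₚ Iₚ
  dilated-Iₚ ω = record
    { d₁₁ = 1ₚ-fixed
    ; d₁₂ = λ m → sym (zeroʳ _)
    ; d₂₁ = λ m → trans (zeroʳ ω) (sym (zeroʳ _))
    ; d₂₂ = 1ₚ-fixed }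
    where
    1ₚ-fixed : ∀ m → 1ₚ m ≈ pow R ω m * 1ₚ m
    1ₚ-fixed zero    = sym (*-identityˡ 1#)
    1ₚ-fixed (suc m) = sym (zeroʳ _)

  -- Dilation is compatible with the factors: F_{ωa}(T) = D⁻¹ F_a(ωT) D.
  dilated-▷ : ∀ {ω a b X Y} → b ≈ ω * a → Dilated ω X Y → Dilated ω (a ▷ X) (b ▷ Y)
  dilated-▷ {ω} {a} {b} {pmat x₁₁ x₁₂ x₂₁ x₂₂} {pmat y₁₁ y₁₂ y₂₁ y₂₂} b≈ωa dil = record
    { d₁₁ = λ m → begin
        y₁₁ m + b * y₂₁ m                       ≈⟨ +-cong (d₁₁ dil m) (*-congʳ b≈ωa) ⟩
        pow R ω m * x₁₁ m + ω * a * y₂₁ m        ≈⟨ +-congˡ (trans (*-congʳ (*-comm ω a)) (*-assoc a ω _)) ⟩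
        pow R ω m * x₁₁ m + a * (ω * y₂₁ m)      ≈⟨ +-congˡ (*-congˡ (d₂₁ dil m)) ⟩
        pow R ω m * x₁₁ m + a * (pow R ω m * x₂₁ m)
          ≈⟨ solve 4 (λ w p a r → w :* p :+ a :* (w :* r) := w :* (p :+ a :* r)) refl (pow R ω m) (x₁₁ m) a (x₂₁ m) ⟩
        pow R ω m * (x₁₁ m + a * x₂₁ m)          ∎
    ; d₁₂ = λ m → trans (+-cong (d₁₂ dil m) (*-cong b≈ωa (d₂₂ dil m)))
        (solve 5 (λ o w q a u → o :* w :* q :+ o :* a :* (w :* u) := o :* w :* (q :+ a :* u))
                 refl ω (pow R ω m) (x₁₂ m) a (x₂₂ m))
    ; d₂₁ = λ { zero → trans (zeroʳ ω) (sym (zeroʳ 1#))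
              ; (suc m) → trans (*-congˡ (d₁₁ dil m)) (sym (*-assoc ω _ _)) }
    ; d₂₂ = λ { zero → sym (zeroʳ 1#) ; (suc m) → d₁₂ dil m } }

  dilated-Π : ∀ {ω a b} → (∀ j → b j ≈ ω * a j) → ∀ k → Dilated ω (Π a k) (Π b k)
  dilated-Π {ω} b≈ωa zero    = dilated-Iₚ ω
  dilated-Π     b≈ωa (suc k) = dilated-▷ (b≈ωa k) (dilated-Π b≈ωa k)

  dilated-tr : ∀ {ω X Y} → Dilated ω X Y → ∀ m → tr Y m ≈ pow R ω m * tr X m
  dilated-tr dil m = trans (+-cong (d₁₁ dil m) (d₂₂ dil m)) (sym (distribˡ _ _ _))

  -- Degree bound: the entries of a product of k factors have degree at most about k/2,
  -- because a T taken from the lower-left entry of one factor is always followed by the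
  -- upper-left entry 1 of the next.
  record HalfDegree (k : ℕ) (X : PMat) : Set ℓ where
    field
      v₁₁ : ∀ m → k < m ℕ.+ m → p₁₁ X m ≈ 0#
      v₁₂ : ∀ m → k ≤ m ℕ.+ m → p₁₂ X m ≈ 0#
      v₂₁ : ∀ m → suc k < m ℕ.+ m → p₂₁ X m ≈ 0#
      v₂₂ : ∀ m → k < m ℕ.+ m → p₂₂ X m ≈ 0#
  open HalfDegree

  halfDegree-Iₚ : HalfDegree 0 Iₚ
  halfDegree-Iₚ = record
    { v₁₁ = 1ₚ-vanishes ; v₁₂ = λ _ _ → refl ; v₂₁ = λ _ _ → refl ; v₂₂ = 1ₚ-vanishes }
    where
    1ₚ-vanishes : ∀ m → 0 < m ℕ.+ m → 1ₚ m ≈ 0#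
    1ₚ-vanishes (suc m) _ = refl

  halfDegree-▷ : ∀ {k X} a → HalfDegree k X → HalfDegree (suc k) (a ▷ X)
  halfDegree-▷ {k} {pmat x₁₁ x₁₂ x₂₁ x₂₂} a deg = record
    { v₁₁ = λ m h → 0+a0 (v₁₁ deg m (ℕₚ.<⇒≤ h)) (v₂₁ deg m h)
    ; v₁₂ = λ m h → 0+a0 (v₁₂ deg m (ℕₚ.<⇒≤ h)) (v₂₂ deg m h)
    ; v₂₁ = λ { zero _ → refl ; (suc m) h → v₁₁ deg m (halve-bound h) }
    ; v₂₂ = λ { zero _ → refl ; (suc m) h → v₁₂ deg m (halve-bound h) } }
    where
    0+a0 : ∀ {x y} → x ≈ 0# → y ≈ 0# → x + a * y ≈ 0#
    0+a0 x≈0 y≈0 = trans (+-cong x≈0 (trans (*-congˡ y≈0) (zeroʳ a))) (+-identityʳ 0#)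

  halfDegree-Π : ∀ a k → HalfDegree k (Π a k)
  halfDegree-Π a zero    = halfDegree-Iₚ
  halfDegree-Π a (suc k) = halfDegree-▷ (a k) (halfDegree-Π a k)

  -- Constant terms: at T = 0 every factor is [[1 , a] , [0 , 0]].
  Π-constant₂₁ : ∀ a k → p₂₁ (Π a k) 0 ≈ 0#
  Π-constant₂₁ a zero    = refl
  Π-constant₂₁ a (suc k) = refl

  Π-constant₁₁ : ∀ a k → p₁₁ (Π a k) 0 ≈ 1#
  Π-constant₁₁ a zero    = refl
  Π-constant₁₁ a (suc k) =
    trans (+-cong (Π-constant₁₁ a k) (trans (*-congˡ (Π-constant₂₁ a k)) (zeroʳ (a k)))) (+-identityʳ 1#)

  tr-Π-constant : ∀ a k → tr (Π a (suc k)) 0 ≈ 1#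
  tr-Π-constant a k = trans (+-identityʳ _) (Π-constant₁₁ a (suc k))

  -- For a primitive n-th root ω, the trace of Π (pow ω) n has no terms of positive degree:
  -- a coefficient of degree m < n is fixed by ω^m ≠ 1, one of degree m ≥ n is beyond n/2.
  tr-Π-vanishes : IsIntegralDomain R → ∀ n → 1 ≤ n → ∀ ω → IsPrimitiveRoot R n ω →
    ∀ m → tr (Π (pow R ω) n) (suc m) ≈ 0#
  tr-Π-vanishes dom (suc k) _ ω (ωⁿ≈1 , ωᵏ≉1) m with suc m <? suc k
  ... | yes m<n = fixed-point-zero dom (pow R ω (suc m)) (tr (Π (pow R ω) (suc k)) (suc m))
                    (sym invariant) (ωᵏ≉1 (suc m) (s≤s z≤n) m<n)
    where
    invariant : tr (Π (pow R ω) (suc k)) (suc m) ≈ pow R ω (suc m) * tr (Π (pow R ω) (suc k)) (suc m)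
    invariant = trans (tr-rotate (pow R ω) k ωⁿ≈1 (suc m))
                      (dilated-tr (dilated-Π (λ _ → refl) (suc k)) (suc m))
  ... | no m≮n = trans (+-cong (v₁₁ deg (suc m) n<2m) (v₂₂ deg (suc m) n<2m)) (+-identityʳ 0#)
    where
    deg = halfDegree-Π (pow R ω) (suc k)
    n<2m : suc k < suc m ℕ.+ suc m
    n<2m = ℕₚ.≤-<-trans (ℕₚ.≮⇒≥ m≮n) (ℕₚ.m<m+n (suc m) (s≤s z≤n))

  -- Evaluation at T = t of the first N coefficients, by Horner's rule.

  ev : Carrier → ℕ → Poly → Carrier
  ev t zero    f = 0#
  ev t (suc N) f = f 0 + t * ev t N (f ∘ suc)

  ev-zero : ∀ t N {f} → (∀ m → f m ≈ 0#) → ev t N f ≈ 0#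
  ev-zero t zero    f≈0 = refl
  ev-zero t (suc N) f≈0 =
    trans (+-cong (f≈0 0) (trans (*-congˡ (ev-zero t N (f≈0 ∘ suc))) (zeroʳ t))) (+-identityʳ 0#)

  ev-+ : ∀ t N f g → ev t N (λ m → f m + g m) ≈ ev t N f + ev t N g
  ev-+ t zero    f g = sym (+-identityʳ 0#)
  ev-+ t (suc N) f g = trans (+-congˡ (*-congˡ (ev-+ t N (f ∘ suc) (g ∘ suc))))
    (solve 5 (λ f₀ g₀ t F G → f₀ :+ g₀ :+ t :* (F :+ G) := f₀ :+ t :* F :+ (g₀ :+ t :* G))
             refl (f 0) (g 0) t (ev t N (f ∘ suc)) (ev t N (g ∘ suc)))

  ev-*ˡ : ∀ t N a f → ev t N (λ m → a * f m) ≈ a * ev t N f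
  ev-*ˡ t zero    a f = sym (zeroʳ a)
  ev-*ˡ t (suc N) a f = trans (+-congˡ (*-congˡ (ev-*ˡ t N a (f ∘ suc))))
    (solve 4 (λ a f₀ t F → a :* f₀ :+ t :* (a :* F) := a :* (f₀ :+ t :* F)) refl a (f 0) t (ev t N (f ∘ suc)))

  record _≈ₘ_ (A B : Mat2 R) : Set ℓ where
    field
      ≈₁₁ : Mat2.a₁₁ A ≈ Mat2.a₁₁ B
      ≈₁₂ : Mat2.a₁₂ A ≈ Mat2.a₁₂ B
      ≈₂₁ : Mat2.a₂₁ A ≈ Mat2.a₂₁ B
      ≈₂₂ : Mat2.a₂₂ A ≈ Mat2.a₂₂ B
  open _≈ₘ_

  evalMat : Carrier → ℕ → PMat → Mat2 R
  evalMat t N X = mat (ev t N (p₁₁ X)) (ev t N (p₁₂ X)) (ev t N (p₂₁ X)) (ev t N (p₂₂ X))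

  eval-Iₚ : ∀ t N → I₂ R ≈ₘ evalMat t (suc N) Iₚ
  eval-Iₚ t N = record { ≈₁₁ = 1≈ev1 ; ≈₁₂ = sym (ev-zero t (suc N) λ _ → refl)
                       ; ≈₂₁ = sym (ev-zero t (suc N) λ _ → refl) ; ≈₂₂ = 1≈ev1 }
    where
    1≈ev1 : 1# ≈ ev t (suc N) 1ₚ
    1≈ev1 = sym (trans (+-congˡ (trans (*-congˡ (ev-zero t N λ _ → refl)) (zeroʳ t))) (+-identityʳ 1#))

  -- Evaluation turns F(a) into M = [[1 , a] , [t , 0]].  The lower row of F(a) X is T times
  -- the upper row of X, so it needs the value of X truncated one coefficient earlier.
  eval-▷ : ∀ t a N {P X} → P ≈ₘ evalMat t (suc N) X → P ≈ₘ evalMat t N X →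
    _⊗_ R (mat 1# a t 0#) P ≈ₘ evalMat t (suc N) (a ▷ X)
  eval-▷ t a N {X = X} P≈X P≈X' = record
    { ≈₁₁ = upper-row (p₁₁ X) (p₂₁ X) (≈₁₁ P≈X) (≈₂₁ P≈X)
    ; ≈₁₂ = upper-row (p₁₂ X) (p₂₂ X) (≈₁₂ P≈X) (≈₂₂ P≈X)
    ; ≈₂₁ = trans (lower-row (≈₁₁ P≈X')) (sym (+-identityˡ _))
    ; ≈₂₂ = trans (lower-row (≈₁₂ P≈X')) (sym (+-identityˡ _)) }
    where
    upper-row : ∀ {x y} f g → x ≈ ev t (suc N) f → y ≈ ev t (suc N) g →
      1# * x + a * y ≈ ev t (suc N) (λ m → f m + a * g m)
    upper-row {x} {y} f g x≈f y≈g = begin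
      1# * x + a * y                             ≈⟨ +-cong (trans (*-identityˡ _) x≈f) (*-congˡ y≈g) ⟩
      ev t (suc N) f + a * ev t (suc N) g        ≈⟨ +-congˡ (ev-*ˡ t (suc N) a g) ⟨
      ev t (suc N) f + ev t (suc N) (λ m → a * g m) ≈⟨ ev-+ t (suc N) f (λ m → a * g m) ⟨
      ev t (suc N) (λ m → f m + a * g m)         ∎
    lower-row : ∀ {x y z} → x ≈ z → t * x + 0# * y ≈ t * z
    lower-row x≈z = trans (+-congˡ (zeroˡ _)) (trans (+-identityʳ _) (*-congˡ x≈z))

  eval-Π : ∀ ω t k N → k < N → prodM R ω t k ≈ₘ evalMat t N (Π (pow R ω) k)
  eval-Π ω t zero    (suc N) _         = eval-Iₚ t N
  eval-Π ω t (suc k) (suc N) (s≤s k<N) =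
    eval-▷ t (pow R ω k) N {X = Π (pow R ω) k} (eval-Π ω t k (suc N) (ℕₚ.m<n⇒m<1+n k<N)) (eval-Π ω t k N k<N)

  tr-Aω : IsIntegralDomain R → ∀ n → 1 ≤ n → ∀ ω → IsPrimitiveRoot R n ω → ∀ t →
    Mat2.a₁₁ (Aω R n ω t) + Mat2.a₂₂ (Aω R n ω t) ≈ 1#
  tr-Aω dom n@(suc k) 1≤n ω prim t = begin
    Mat2.a₁₁ (prodM R ω t n) + Mat2.a₂₂ (prodM R ω t n)
      ≈⟨ +-cong (≈₁₁ values) (≈₂₂ values) ⟩
    ev t (suc n) (p₁₁ (Π (pow R ω) n)) + ev t (suc n) (p₂₂ (Π (pow R ω) n))
      ≈⟨ ev-+ t (suc n) (p₁₁ (Π (pow R ω) n)) (p₂₂ (Π (pow R ω) n)) ⟨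
    ev t (suc n) (tr (Π (pow R ω) n))
      ≈⟨ +-cong (tr-Π-constant (pow R ω) k) (*-congˡ (ev-zero t n (tr-Π-vanishes dom n 1≤n ω prim))) ⟩
    1# + t * 0#
      ≈⟨ trans (+-congˡ (zeroʳ t)) (+-identityʳ 1#) ⟩
    1# ∎
    where
    values = eval-Π ω t n (suc n) (ℕₚ.n<1+n n)

lemma5p2 : ∀ {c ℓ} (R : CommutativeRing c ℓ) → IsIntegralDomain R →
    (n : ℕ) → 1 ≤ n → (ω : CommutativeRing.Carrier R) → IsPrimitiveRoot R n ω →
    (t : CommutativeRing.Carrier R) →
    _≈ₚ_ R (charPoly R (Aω R n ω t)) (charPoly R (A R (pow R t n)))
lemma5p2 R dom n 1≤n ω prim t = determinant ∷ -‿cong trace ∷ refl ∷ []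
  where
  open CommutativeRing R
  determinant : det R (Aω R n ω t) ≈ 1# * 0# - pow R t n * 1#
  determinant = trans (det-Aω R dom n 1≤n ω prim t)
    (sym (trans (+-cong (zeroʳ 1#) (-‿cong (*-identityʳ _))) (+-identityˡ _)))
  trace : Mat2.a₁₁ (Aω R n ω t) + Mat2.a₂₂ (Aω R n ω t) ≈ 1# + 0#
  trace = trans (tr-Aω R dom n 1≤n ω prim t) (sym (+-identityʳ 1#))
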